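{- Let $n\in\mathbb N$ and let $A\subseteq\mathbb Z_n\setminus\{0\}$ be nonempty with $A=-A$. Then $C_n(A)$ has nonadjacent twins if and only if there exists $w\in\mathbb Z_n$ with $w\neq 0$ and $w\notin U(n)$ such that $A$ is a union of nontrivial cosets of $\langle w\rangle$ (cosets other than $\langle w\rangle$ itself). In this case, the nonadjacent twin classes of $C_n(A)$ are the cosets of $\langle w\rangle$, where $w$ is an element of $\mathbb Z_n$ of maximum additive order satisfying the preceding condition.
   Context: The circulant graph $C_n(A)$ has vertex set $\mathbb Z_n$, with $u,v$ adjacent iff $u-v\in A$. $U(n)$ denotes the group of units of $\mathbb Z_n$, and $\langle w\rangle$ the additive cyclic subgroup generated by $w$. Distinct vertices $u,v$ are nonadjacent twins if $N(u)=N(v)$ (open neighborhoods); the nonadjacent twin classes are the equivalence classes of the relation $N(u)=N(v)$. -}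

module Defs where

open import Level using (0ℓ)
open import Data.Nat using (ℕ; zero; suc; _+_; _*_; _∸_; _≤_; _<_; NonZero)
open import Data.Nat.DivMod using (_%_; m%n<n)
open import Data.Fin using (Fin; toℕ; fromℕ<)
open import Data.Fin.Subset using (Subset; _∈_; _∉_)
open import Data.Product using (Σ; ∃; _×_; _,_)
open import Relation.Binary.PropositionalEquality using (_≡_; _≢_)
open import Relation.Nullary using (¬_)
open import Function.Bundles using (_⇔_)

-- Z_n is represented by Fin n (residues 0..n-1), for n ≠ 0.
module _ {n : ℕ} .{{_ : NonZero n}} where

  [_]ₙ : ℕ → Fin n
  [ m ]ₙ = fromℕ< (m%n<n m n)

  0ₙ : Fin n
  0ₙ = [ 0 ]ₙ

  -- the one of Z_n (equals 0 when n = 1)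
  1ₙ : Fin n
  1ₙ = [ 1 ]ₙ

  infixl 6 _⊕_ _⊖_
  infixl 7 _⊗_ _·_

  _⊕_ : Fin n → Fin n → Fin n
  a ⊕ b = [ toℕ a + toℕ b ]ₙ

  ⊝_ : Fin n → Fin n
  ⊝ a = [ n ∸ toℕ a ]ₙ

  _⊖_ : Fin n → Fin n → Fin n
  a ⊖ b = a ⊕ (⊝ b)

  _⊗_ : Fin n → Fin n → Fin n
  a ⊗ b = [ toℕ a * toℕ b ]ₙ

  _·_ : ℕ → Fin n → Fin n
  k · w = [ k * toℕ w ]ₙ

  IsUnit : Fin n → Set
  IsUnit w = ∃ λ y → w ⊗ y ≡ 1ₙ

  _∈⟨_⟩ : Fin n → Fin n → Set
  x ∈⟨ w ⟩ = ∃ λ (k : ℕ) → x ≡ k · w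

  _∈_+⟨_⟩ : Fin n → Fin n → Fin n → Set
  x ∈ a +⟨ w ⟩ = ∃ λ h → h ∈⟨ w ⟩ × x ≡ a ⊕ h

  IsOrder : Fin n → ℕ → Set
  IsOrder w k = (0 < k) × (k · w ≡ 0ₙ) × (∀ j → 0 < j → j · w ≡ 0ₙ → k ≤ j)

  -- A is a union of nontrivial cosets of ⟨w⟩ (cosets different from ⟨w⟩):
  -- every a ∈ A lies in a coset a + ⟨w⟩ which is nontrivial (a ∉ ⟨w⟩)
  -- and entirely contained in A.
  UnionOfNontrivialCosets : Fin n → Subset n → Set
  UnionOfNontrivialCosets w A =
    ∀ a → a ∈ A → ¬ (a ∈⟨ w ⟩) × (∀ x → x ∈ a +⟨ w ⟩ → x ∈ A)

  Admissible : Subset n → Fin n → Set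
  Admissible A w = (w ≢ 0ₙ) × ¬ IsUnit w × UnionOfNontrivialCosets w A

  Adj : Subset n → Fin n → Fin n → Set
  Adj A u v = (u ⊖ v) ∈ A

  SameNbhd : Subset n → Fin n → Fin n → Set
  SameNbhd A u v = ∀ x → Adj A u x ⇔ Adj A v x

  HasNonadjTwins : Subset n → Set
  HasNonadjTwins A = ∃ λ u → ∃ λ v → (u ≢ v) × SameNbhd A u v

-- Call s ∈ ℤₙ a period of A when A + s ⊆ A.  In C_n(A) we have N(u) = N(v) exactly when v − u
-- is a period, and as 0 ∉ A ≠ ∅ a nonzero w is admissible exactly when it is a period.  So the
-- twin classes are the cosets of the group of periods, and it remains to see that this group is
-- generated by an admissible w of maximal order: for any period s, gcd(w, s, n) generates a group
-- of periods containing w and s whose order is bounded by that of w, so it equals ⟨w⟩.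

{-# OPTIONS --safe #-}
module Submission where

open import Defs
open import Level using (0ℓ)
open import Algebra.Bundles using (AbelianGroup)
open import Algebra.Consequences.Propositional using (comm∧idˡ⇒id; comm∧invʳ⇒inv)
import Algebra.Properties.AbelianGroup as AbelianGroupProperties
open import Data.Nat using (ℕ; zero; suc; pred; _+_; _*_; _∸_; _≤_; _<_; NonZero; ≢-nonZero; ≢-nonZero⁻¹; >-nonZero; >-nonZero⁻¹)
open import Data.Nat.Properties using (*-zeroʳ; module ≤-Reasoning; <⇒≤; +-comm; +-assoc; *-assoc; *-comm; *-identityʳ; *-distribʳ-+; m+[n∸m]≡n; suc-pred; *-cancelˡ-≤; *-monoˡ-≤; ≤-antisym; ≤-trans)
open import Data.Nat.DivMod using (_%_; m%n<n; %-distribˡ-+; m<n⇒m%n≡m)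
open import Data.Nat.Divisibility using (_∣_; divides; ∣-refl; ∣-trans; ∣⇒≤; m∣m*n; *-monoʳ-∣; *-cancelʳ-∣; m%n≡0⇒n∣m; n∣m⇒m%n≡0)
open import Data.Nat.GCD using (gcd; gcd-GCD; gcd[m,n]∣m; gcd[m,n]∣n; module Bézout)
open import Data.Fin using (Fin; toℕ)
open import Data.Fin.Properties using (toℕ-injective; toℕ<n; toℕ-fromℕ<)
open import Data.Fin.Subset using (Subset; _∈_; _∉_)
open import Data.Product using (∃; _×_; _,_; proj₁; proj₂)
open import Function.Bundles using (_⇔_; mk⇔; Equivalence)
open import Function.Construct.Composition using (_⇔-∘_)
open import Function.Construct.Symmetry using (⇔-sym)
open import Relation.Binary.PropositionalEquality using (_≡_; _≢_; refl; sym; trans; cong; cong₂; subst; isEquivalence; module ≡-Reasoning)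
open import Relation.Nullary using (¬_)

module _ {n : ℕ} .{{_ : NonZero n}} where

  toℕ-[]ₙ : ∀ a → toℕ {n} [ a ]ₙ ≡ a % n
  toℕ-[]ₙ a = toℕ-fromℕ< (m%n<n a n)

  []ₙ-cong-% : ∀ {a b} → a % n ≡ b % n → [ a ]ₙ ≡ [ b ]ₙ
  []ₙ-cong-% {a} {b} eq = toℕ-injective (trans (toℕ-[]ₙ a) (trans eq (sym (toℕ-[]ₙ b))))

  []ₙ-toℕ : ∀ (x : Fin n) → [ toℕ x ]ₙ ≡ x
  []ₙ-toℕ x = toℕ-injective (trans (toℕ-[]ₙ (toℕ x)) (m<n⇒m%n≡m (toℕ<n x)))

  0%n≡0 : 0 % n ≡ 0
  0%n≡0 = m<n⇒m%n≡m (>-nonZero⁻¹ n)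

  ∣⇒[]ₙ≡0ₙ : ∀ {a} → n ∣ a → [ a ]ₙ ≡ 0ₙ
  ∣⇒[]ₙ≡0ₙ {a} n∣a = []ₙ-cong-% (trans (n∣m⇒m%n≡0 a n n∣a) (sym 0%n≡0))

  []ₙ≡0ₙ⇒∣ : ∀ {a} → [ a ]ₙ ≡ 0ₙ → n ∣ a
  []ₙ≡0ₙ⇒∣ {a} eq = m%n≡0⇒n∣m a n (begin
    a % n             ≡⟨ toℕ-[]ₙ a ⟨
    toℕ {n} [ a ]ₙ    ≡⟨ cong toℕ eq ⟩
    toℕ {n} 0ₙ        ≡⟨ toℕ-[]ₙ 0 ⟩
    0 % n             ≡⟨ 0%n≡0 ⟩
    0                 ∎)
    where open ≡-Reasoning

  []ₙ-homo-+ : ∀ a b → [ a + b ]ₙ ≡ [ a ]ₙ ⊕ [ b ]ₙ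
  []ₙ-homo-+ a b = []ₙ-cong-% (begin
    (a + b) % n                                 ≡⟨ %-distribˡ-+ a b n ⟩
    (a % n + b % n) % n                         ≡⟨ cong₂ (λ p q → (p + q) % n) (toℕ-[]ₙ a) (toℕ-[]ₙ b) ⟨
    (toℕ {n} [ a ]ₙ + toℕ {n} [ b ]ₙ) % n       ∎)
    where open ≡-Reasoning

  ⊕-comm : ∀ (x y : Fin n) → x ⊕ y ≡ y ⊕ x
  ⊕-comm x y = cong [_]ₙ (+-comm (toℕ x) (toℕ y))

  ⊕-assoc : ∀ (x y z : Fin n) → (x ⊕ y) ⊕ z ≡ x ⊕ (y ⊕ z)
  ⊕-assoc x y z = begin
    [ x′ + y′ ]ₙ ⊕ z          ≡⟨ cong ([ x′ + y′ ]ₙ ⊕_) ([]ₙ-toℕ z) ⟨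
    [ x′ + y′ ]ₙ ⊕ [ z′ ]ₙ    ≡⟨ []ₙ-homo-+ (x′ + y′) z′ ⟨
    [ x′ + y′ + z′ ]ₙ         ≡⟨ cong [_]ₙ (+-assoc x′ y′ z′) ⟩
    [ x′ + (y′ + z′) ]ₙ       ≡⟨ []ₙ-homo-+ x′ (y′ + z′) ⟩
    [ x′ ]ₙ ⊕ (y ⊕ z)         ≡⟨ cong (_⊕ (y ⊕ z)) ([]ₙ-toℕ x) ⟩
    x ⊕ (y ⊕ z)               ∎
    where
    open ≡-Reasoning
    x′ = toℕ x; y′ = toℕ y; z′ = toℕ z

  ⊕-identityˡ : ∀ (x : Fin n) → 0ₙ ⊕ x ≡ x
  ⊕-identityˡ x = begin
    0ₙ ⊕ x              ≡⟨ cong (0ₙ ⊕_) ([]ₙ-toℕ x) ⟨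
    [ 0 ]ₙ ⊕ [ toℕ x ]ₙ ≡⟨ []ₙ-homo-+ 0 (toℕ x) ⟨
    [ toℕ x ]ₙ          ≡⟨ []ₙ-toℕ x ⟩
    x                   ∎
    where open ≡-Reasoning

  ⊕-inverseʳ : ∀ (x : Fin n) → x ⊕ ⊝ x ≡ 0ₙ
  ⊕-inverseʳ x = begin
    x ⊕ ⊝ x                    ≡⟨ cong (_⊕ ⊝ x) ([]ₙ-toℕ x) ⟨
    [ toℕ x ]ₙ ⊕ [ n ∸ toℕ x ]ₙ ≡⟨ []ₙ-homo-+ (toℕ x) (n ∸ toℕ x) ⟨
    [ toℕ x + (n ∸ toℕ x) ]ₙ   ≡⟨ cong [_]ₙ (m+[n∸m]≡n (<⇒≤ (toℕ<n x))) ⟩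
    [ n ]ₙ                     ≡⟨ ∣⇒[]ₙ≡0ₙ ∣-refl ⟩
    0ₙ                         ∎
    where open ≡-Reasoning

  ⊕-⊝-abelianGroup : AbelianGroup 0ℓ 0ℓ
  ⊕-⊝-abelianGroup = record
    { Carrier        = Fin n
    ; _≈_            = _≡_
    ; _∙_            = _⊕_
    ; ε              = 0ₙ
    ; _⁻¹            = ⊝_
    ; isAbelianGroup = record
      { isGroup = record
        { isMonoid = record
          { isSemigroup = record
            { isMagma = record { isEquivalence = isEquivalence ; ∙-cong = cong₂ _⊕_ }
            ; assoc   = ⊕-assoc
            }
          ; identity = comm∧idˡ⇒id ⊕-comm ⊕-identityˡ
          }
        ; inverse = comm∧invʳ⇒inv ⊕-comm ⊕-inverseʳ
        ; ⁻¹-cong = cong ⊝_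
        }
      ; comm = ⊕-comm
      }
    }

  open AbelianGroupProperties ⊕-⊝-abelianGroup
    using (x≈z//y; //-rightDividesˡ; xyx⁻¹≈y; x∙y⁻¹≈ε⇒x≈y; inverseʳ-unique; ⁻¹-anti-homo-//; \\-leftDividesʳ; ε⁻¹≈ε)
  open AbelianGroup ⊕-⊝-abelianGroup using (identityʳ)

  x⊖[x⊖y]≡y : ∀ (x y : Fin n) → x ⊖ (x ⊖ y) ≡ y
  x⊖[x⊖y]≡y x y = sym (x≈z//y y (x ⊖ y) x (trans (⊕-comm y (x ⊖ y)) (//-rightDividesˡ y x)))

  [x⊖y]⊕[z⊖x]≡z⊖y : ∀ (x y z : Fin n) → (x ⊖ y) ⊕ (z ⊖ x) ≡ z ⊖ y
  [x⊖y]⊕[z⊖x]≡z⊖y x y z = begin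
    (x ⊖ y) ⊕ (z ⊖ x)     ≡⟨ ⊕-comm (x ⊖ y) (z ⊖ x) ⟩
    z ⊕ ⊝ x ⊕ (x ⊖ y)     ≡⟨ ⊕-assoc z (⊝ x) (x ⊖ y) ⟩
    z ⊕ (⊝ x ⊕ (x ⊖ y))   ≡⟨ cong (z ⊕_) (\\-leftDividesʳ x (⊝ y)) ⟩
    z ⊖ y                 ∎
    where open ≡-Reasoning

  x⊕[y⊖x]≡y : ∀ (x y : Fin n) → x ⊕ (y ⊖ x) ≡ y
  x⊕[y⊖x]≡y x y = trans (⊕-comm x (y ⊖ x)) (//-rightDividesˡ x y)

  x⊖0ₙ≡x : ∀ (x : Fin n) → x ⊖ 0ₙ ≡ x
  x⊖0ₙ≡x x = trans (cong (x ⊕_) ε⁻¹≈ε) (identityʳ x)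

  ·-suc : ∀ k (x : Fin n) → suc k · x ≡ x ⊕ k · x
  ·-suc k x = trans ([]ₙ-homo-+ (toℕ x) (k * toℕ x)) (cong (_⊕ k · x) ([]ₙ-toℕ x))

  1·x≡x : ∀ (x : Fin n) → 1 · x ≡ x
  1·x≡x x = trans (·-suc 0 x) (trans (⊕-comm x 0ₙ) (⊕-identityˡ x))

  ·-distribʳ-+ : ∀ i j (x : Fin n) → (i + j) · x ≡ i · x ⊕ j · x
  ·-distribʳ-+ i j x = trans (cong [_]ₙ (*-distribʳ-+ (toℕ x) i j)) ([]ₙ-homo-+ (i * toℕ x) (j * toℕ x))

  []ₙ-homo-· : ∀ k a → [ k * a ]ₙ ≡ k · [ a ]ₙ
  []ₙ-homo-· zero    a = refl
  []ₙ-homo-· (suc k) a = begin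
    [ a + k * a ]ₙ        ≡⟨ []ₙ-homo-+ a (k * a) ⟩
    [ a ]ₙ ⊕ [ k * a ]ₙ   ≡⟨ cong ([ a ]ₙ ⊕_) ([]ₙ-homo-· k a) ⟩
    [ a ]ₙ ⊕ k · [ a ]ₙ   ≡⟨ ·-suc k [ a ]ₙ ⟨
    suc k · [ a ]ₙ        ∎
    where open ≡-Reasoning

  -- This is why every submonoid of ℤₙ is a subgroup.
  ⊝x≡pred[n]·x : ∀ (x : Fin n) → ⊝ x ≡ pred n · x
  ⊝x≡pred[n]·x x = sym (inverseʳ-unique x (pred n · x) (begin
    x ⊕ pred n · x       ≡⟨ ·-suc (pred n) x ⟨
    suc (pred n) · x     ≡⟨ cong (_· x) (suc-pred n) ⟩
    [ n * toℕ x ]ₙ       ≡⟨ ∣⇒[]ₙ≡0ₙ (m∣m*n (toℕ x)) ⟩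
    0ₙ                   ∎))
    where open ≡-Reasoning

  m+n≡o⇒[m]ₙ≡[o]ₙ⊖[n]ₙ : ∀ {a b c} → a + b ≡ c → [ a ]ₙ ≡ [ c ]ₙ ⊖ [ b ]ₙ
  m+n≡o⇒[m]ₙ≡[o]ₙ⊖[n]ₙ {a} {b} eq = x≈z//y [ a ]ₙ [ b ]ₙ _ (trans (sym ([]ₙ-homo-+ a b)) (cong [_]ₙ eq))

  unit⇒∈⟨⟩ : ∀ {w} → IsUnit w → ∀ (x : Fin n) → x ∈⟨ w ⟩
  unit⇒∈⟨⟩ {w} (y , w⊗y≡1ₙ) x = x′ * y′ , (begin
    x                          ≡⟨ []ₙ-toℕ x ⟨
    [ x′ ]ₙ                    ≡⟨ cong [_]ₙ (*-identityʳ x′) ⟨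
    [ x′ * 1 ]ₙ                ≡⟨ []ₙ-homo-· x′ 1 ⟩
    x′ · 1ₙ                    ≡⟨ cong (x′ ·_) w⊗y≡1ₙ ⟨
    x′ · [ w′ * y′ ]ₙ          ≡⟨ []ₙ-homo-· x′ (w′ * y′) ⟨
    [ x′ * (w′ * y′) ]ₙ        ≡⟨ cong (λ m → [ x′ * m ]ₙ) (*-comm w′ y′) ⟩
    [ x′ * (y′ * w′) ]ₙ        ≡⟨ cong [_]ₙ (*-assoc x′ y′ w′) ⟨
    (x′ * y′) · w              ∎)
    where
    open ≡-Reasoning
    x′ = toℕ x; y′ = toℕ y; w′ = toℕ w

  record IsSubmonoid (P : Fin n → Set) : Set where
    field
      0ₙ-closed : P 0ₙ
      ⊕-closed  : ∀ {x y} → P x → P y → P (x ⊕ y)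

    ·-closed : ∀ k {x} → P x → P (k · x)
    ·-closed zero    px = 0ₙ-closed
    ·-closed (suc k) {x} px = subst P (sym (·-suc k x)) (⊕-closed px (·-closed k px))

    ⊝-closed : ∀ {x} → P x → P (⊝ x)
    ⊝-closed {x} px = subst P (sym (⊝x≡pred[n]·x x)) (·-closed (pred n) px)

    ⟨⟩⊆ : ∀ {w x} → P w → x ∈⟨ w ⟩ → P x
    ⟨⟩⊆ pw (k , refl) = ·-closed k pw

    toℕ-closed : ∀ {x} → P x → P [ toℕ x ]ₙ
    toℕ-closed {x} = subst P (sym ([]ₙ-toℕ x))

    [n]ₙ-closed : P [ n ]ₙ
    [n]ₙ-closed = subst P (sym (∣⇒[]ₙ≡0ₙ ∣-refl)) 0ₙ-closed

    []ₙ-*-closed : ∀ k {a} → P [ a ]ₙ → P [ k * a ]ₙ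
    []ₙ-*-closed k {a} pa = subst P (sym ([]ₙ-homo-· k a)) (·-closed k pa)

    []ₙ-∣-closed : ∀ {a b} → P [ a ]ₙ → a ∣ b → P [ b ]ₙ
    []ₙ-∣-closed pa (divides k refl) = []ₙ-*-closed k pa

    []ₙ-gcd-closed : ∀ {a b} → P [ a ]ₙ → P [ b ]ₙ → P [ gcd a b ]ₙ
    []ₙ-gcd-closed {a} {b} pa pb with Bézout.identity (gcd-GCD a b)
    ... | Bézout.+- x y eq =
      subst P (sym (m+n≡o⇒[m]ₙ≡[o]ₙ⊖[n]ₙ eq)) (⊕-closed ([]ₙ-*-closed x pa) (⊝-closed ([]ₙ-*-closed y pb)))
    ... | Bézout.-+ x y eq =
      subst P (sym (m+n≡o⇒[m]ₙ≡[o]ₙ⊖[n]ₙ eq)) (⊕-closed ([]ₙ-*-closed y pb) (⊝-closed ([]ₙ-*-closed x pa)))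

  ⟨⟩-isSubmonoid : ∀ w → IsSubmonoid (_∈⟨ w ⟩)
  ⟨⟩-isSubmonoid w = record
    { 0ₙ-closed = 0 , refl
    ; ⊕-closed  = λ { (i , refl) (j , refl) → i + j , sym (·-distribʳ-+ i j w) }
    }

  x∈⟨x⟩ : ∀ (x : Fin n) → x ∈⟨ x ⟩
  x∈⟨x⟩ x = 1 , sym (1·x≡x x)

  ∈-+⟨⟩⇔⊖∈⟨⟩ : ∀ {u v w : Fin n} → (v ∈ u +⟨ w ⟩) ⇔ ((v ⊖ u) ∈⟨ w ⟩)
  ∈-+⟨⟩⇔⊖∈⟨⟩ {u} {v} {w} = mk⇔
    (λ { (h , h∈⟨w⟩ , refl) → subst (_∈⟨ w ⟩) (sym (xyx⁻¹≈y u h)) h∈⟨w⟩ })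
    (λ v⊖u∈⟨w⟩ → v ⊖ u , v⊖u∈⟨w⟩ , sym (x⊕[y⊖x]≡y u v))

  factorˡ-nonZero : ∀ {q g} → n ≡ q * g → NonZero q
  factorˡ-nonZero {q} {g} n≡q*g = ≢-nonZero λ q≡0 → ≢-nonZero⁻¹ n (trans n≡q*g (cong (_* g) q≡0))

  factorʳ-nonZero : ∀ {q g} → n ≡ q * g → NonZero g
  factorʳ-nonZero {q} {g} n≡q*g =
    ≢-nonZero λ g≡0 → ≢-nonZero⁻¹ n (trans n≡q*g (trans (cong (q *_) g≡0) (*-zeroʳ q)))

  isOrder-[]ₙ : ∀ {q g} → n ≡ q * g → IsOrder [ g ]ₙ q
  isOrder-[]ₙ {q} {g} n≡q*g = >-nonZero⁻¹ q {{factorˡ-nonZero n≡q*g}} , q·[g]ₙ≡0ₙ , q-least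
    where
    q·[g]ₙ≡0ₙ : q · [ g ]ₙ ≡ 0ₙ
    q·[g]ₙ≡0ₙ = trans (sym ([]ₙ-homo-· q g)) (∣⇒[]ₙ≡0ₙ (subst (n ∣_) n≡q*g ∣-refl))

    q-least : ∀ j → 0 < j → j · [ g ]ₙ ≡ 0ₙ → q ≤ j
    q-least j 0<j j·[g]ₙ≡0ₙ = ∣⇒≤ {{>-nonZero 0<j}}
      (*-cancelʳ-∣ g {{factorʳ-nonZero {q} n≡q*g}}
        (subst (_∣ j * g) n≡q*g ([]ₙ≡0ₙ⇒∣ (trans ([]ₙ-homo-· j g) j·[g]ₙ≡0ₙ))))

  isOrder⇒≤-cofactor : ∀ {x k g r} → IsOrder x k → g ∣ toℕ x → n ≡ r * g → k ≤ r
  isOrder⇒≤-cofactor {x} {k} {g} {r} (_ , _ , k-least) g∣x n≡r*g =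
    k-least r (>-nonZero⁻¹ r {{factorˡ-nonZero n≡r*g}})
      (∣⇒[]ₙ≡0ₙ (subst (_∣ r * toℕ x) (sym n≡r*g) (*-monoʳ-∣ r g∣x)))

  ∣∧cofactor-≤⇒≡ : ∀ {g g′ q r} → g ∣ g′ → n ≡ q * g → n ≡ r * g′ → q ≤ r → g ≡ g′
  ∣∧cofactor-≤⇒≡ {g} {g′} {q} {r} g∣g′ n≡q*g n≡r*g′ q≤r = ≤-antisym
    (∣⇒≤ {{factorʳ-nonZero {r} n≡r*g′}} g∣g′)
    (*-cancelˡ-≤ r {{factorˡ-nonZero n≡r*g′}} (begin
      r * g′  ≡⟨ n≡r*g′ ⟨
      n       ≡⟨ n≡q*g ⟩
      q * g   ≤⟨ *-monoˡ-≤ g q≤r ⟩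
      r * g   ∎))
    where open ≤-Reasoning

  IsPeriod : Subset n → Fin n → Set
  IsPeriod A s = ∀ y → y ∈ A → y ⊕ s ∈ A

  module _ {A : Subset n} where

    period-isSubmonoid : IsSubmonoid (IsPeriod A)
    period-isSubmonoid = record
      { 0ₙ-closed = λ y y∈A → subst (_∈ A) (sym (identityʳ y)) y∈A
      ; ⊕-closed  = λ {s} {t} ps pt y y∈A → subst (_∈ A) (⊕-assoc y s t) (pt _ (ps y y∈A))
      }

    private module Period = IsSubmonoid period-isSubmonoid

    sameNbhd⇔period : ∀ {u v} → SameNbhd A u v ⇔ IsPeriod A (v ⊖ u)
    sameNbhd⇔period {u} {v} = mk⇔ to from
      where
      to : SameNbhd A u v → IsPeriod A (v ⊖ u)
      to same y y∈A = subst (_∈ A) v⊖[u⊖y]≡y⊕[v⊖u]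
        (Equivalence.to (same (u ⊖ y)) (subst (_∈ A) (sym (x⊖[x⊖y]≡y u y)) y∈A))
        where
        v⊖[u⊖y]≡y⊕[v⊖u] : v ⊖ (u ⊖ y) ≡ y ⊕ (v ⊖ u)
        v⊖[u⊖y]≡y⊕[v⊖u] = trans (sym ([x⊖y]⊕[z⊖x]≡z⊖y u (u ⊖ y) v)) (cong (_⊕ (v ⊖ u)) (x⊖[x⊖y]≡y u y))

      from : IsPeriod A (v ⊖ u) → SameNbhd A u v
      from p x = mk⇔
        (λ u⊖x∈A → subst (_∈ A) ([x⊖y]⊕[z⊖x]≡z⊖y u x v) (p _ u⊖x∈A))
        (λ v⊖x∈A → subst (_∈ A) ([x⊖y]⊕[z⊖x]≡z⊖y v x u) (p⁻¹ _ v⊖x∈A))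
        where
        p⁻¹ : IsPeriod A (u ⊖ v)
        p⁻¹ = subst (IsPeriod A) (⁻¹-anti-homo-// v u) (Period.⊝-closed p)

    unionOfNontrivialCosets⇒period : ∀ {w} → UnionOfNontrivialCosets w A → IsPeriod A w
    unionOfNontrivialCosets⇒period {w} union y y∈A = proj₂ (union y y∈A) (y ⊕ w) (w , x∈⟨x⟩ w , refl)

    period⇒unionOfNontrivialCosets : ∀ {w} → 0ₙ ∉ A → IsPeriod A w → UnionOfNontrivialCosets w A
    period⇒unionOfNontrivialCosets {w} 0ₙ∉A pw a a∈A = a∉⟨w⟩ , a+⟨w⟩⊆A
      where
      a∉⟨w⟩ : ¬ a ∈⟨ w ⟩
      a∉⟨w⟩ a∈⟨w⟩ = 0ₙ∉A (subst (_∈ A) (⊕-inverseʳ a) (Period.⊝-closed (Period.⟨⟩⊆ pw a∈⟨w⟩) a a∈A))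

      a+⟨w⟩⊆A : ∀ x → x ∈ a +⟨ w ⟩ → x ∈ A
      a+⟨w⟩⊆A x (h , h∈⟨w⟩ , refl) = Period.⟨⟩⊆ pw h∈⟨w⟩ a a∈A

    nonempty∧unionOfNontrivialCosets⇒¬unit : ∀ {w} → (∃ λ a → a ∈ A) → UnionOfNontrivialCosets w A → ¬ IsUnit w
    nonempty∧unionOfNontrivialCosets⇒¬unit (a , a∈A) union unit = proj₁ (union a a∈A) (unit⇒∈⟨⟩ unit a)

    module _ (nonempty : ∃ λ a → a ∈ A) (0ₙ∉A : 0ₙ ∉ A) where

      period⇒admissible : ∀ {s} → IsPeriod A s → s ≢ 0ₙ → Admissible A s
      period⇒admissible ps s≢0ₙ = s≢0ₙ , nonempty∧unionOfNontrivialCosets⇒¬unit nonempty union , union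
        where union = period⇒unionOfNontrivialCosets 0ₙ∉A ps

      hasNonadjTwins⇔admissible : HasNonadjTwins A ⇔ (∃ λ w → Admissible A w)
      hasNonadjTwins⇔admissible = mk⇔
        (λ (u , v , u≢v , same) → v ⊖ u , period⇒admissible (Equivalence.to sameNbhd⇔period same)
                                                              (λ v⊖u≡0ₙ → u≢v (sym (x∙y⁻¹≈ε⇒x≈y v u v⊖u≡0ₙ))))
        (λ (w , w≢0ₙ , _ , union) → 0ₙ , w , (λ 0ₙ≡w → w≢0ₙ (sym 0ₙ≡w)) , Equivalence.from sameNbhd⇔period
                                      (subst (IsPeriod A) (sym (x⊖0ₙ≡x w)) (unionOfNontrivialCosets⇒period union)))

      -- [ g′ ]ₙ generates ⟨w⟩ and the period [ g ]ₙ generates ⟨w, s⟩; maximality of k gives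
      -- n / g ≤ k ≤ n / g′, which forces g = g′.
      period⇒∈⟨maximal⟩ : ∀ {w k s} → Admissible A w → IsOrder w k
        → (∀ w′ k′ → Admissible A w′ → IsOrder w′ k′ → k′ ≤ k)
        → IsPeriod A s → s ∈⟨ w ⟩
      period⇒∈⟨maximal⟩ {w} {k} {s} (w≢0ₙ , _ , union) w-order maximal ps =
        subst (_∈⟨ w ⟩) ([]ₙ-toℕ s) (⟨w⟩.[]ₙ-∣-closed [g′]ₙ∈⟨w⟩ g′∣b)
        where
        module ⟨w⟩ = IsSubmonoid (⟨⟩-isSubmonoid w)
        a = toℕ w
        b = toℕ s
        g′ = gcd a n
        g = gcd g′ b
        g′∣a = gcd[m,n]∣m a n
        g′∣n = gcd[m,n]∣n a n
        g∣g′ = gcd[m,n]∣m g′ b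
        g∣n = ∣-trans g∣g′ g′∣n

        [g′]ₙ∈⟨w⟩ : [ g′ ]ₙ ∈⟨ w ⟩
        [g′]ₙ∈⟨w⟩ = ⟨w⟩.[]ₙ-gcd-closed (⟨w⟩.toℕ-closed (x∈⟨x⟩ w)) ⟨w⟩.[n]ₙ-closed

        [g]ₙ-period : IsPeriod A [ g ]ₙ
        [g]ₙ-period = Period.[]ₙ-gcd-closed
          (Period.[]ₙ-gcd-closed (Period.toℕ-closed (unionOfNontrivialCosets⇒period union)) Period.[n]ₙ-closed)
          (Period.toℕ-closed ps)

        [g]ₙ≢0ₙ : [ g ]ₙ ≢ 0ₙ
        [g]ₙ≢0ₙ [g]ₙ≡0ₙ = w≢0ₙ (trans (sym ([]ₙ-toℕ w)) (∣⇒[]ₙ≡0ₙ (∣-trans ([]ₙ≡0ₙ⇒∣ [g]ₙ≡0ₙ) (∣-trans g∣g′ g′∣a))))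

        n/g≤k : _∣_.quotient g∣n ≤ k
        n/g≤k = maximal [ g ]ₙ _ (period⇒admissible [g]ₙ-period [g]ₙ≢0ₙ) (isOrder-[]ₙ (_∣_.equality g∣n))

        k≤n/g′ : k ≤ _∣_.quotient g′∣n
        k≤n/g′ = isOrder⇒≤-cofactor w-order g′∣a (_∣_.equality g′∣n)

        g′∣b : g′ ∣ b
        g′∣b = subst (_∣ b) (∣∧cofactor-≤⇒≡ g∣g′ (_∣_.equality g∣n) (_∣_.equality g′∣n) (≤-trans n/g≤k k≤n/g′))
                     (gcd[m,n]∣n g′ b)

      period⇔∈⟨maximal⟩ : ∀ {w k s} → Admissible A w → IsOrder w k
        → (∀ w′ k′ → Admissible A w′ → IsOrder w′ k′ → k′ ≤ k)
        → IsPeriod A s ⇔ s ∈⟨ w ⟩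
      period⇔∈⟨maximal⟩ adm@(_ , _ , union) w-order maximal = mk⇔
        (period⇒∈⟨maximal⟩ adm w-order maximal)
        (Period.⟨⟩⊆ (unionOfNontrivialCosets⇒period union))

proposition14 : (n : ℕ) .{{_ : NonZero n}} (A : Subset n)
    → (∃ λ a → a ∈ A)
    → 0ₙ ∉ A
    → (∀ a → a ∈ A → (⊝ a) ∈ A)
    → (HasNonadjTwins A ⇔ (∃ λ w → Admissible A w))
      × (∀ w k → Admissible A w → IsOrder w k
           → (∀ w′ k′ → Admissible A w′ → IsOrder w′ k′ → k′ ≤ k)
           → ∀ u v → SameNbhd A u v ⇔ v ∈ u +⟨ w ⟩)
proposition14 n A nonempty 0ₙ∉A _ =
  hasNonadjTwins⇔admissible nonempty 0ₙ∉A ,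
  λ w k adm w-order maximal u v →
    ⇔-sym ∈-+⟨⟩⇔⊖∈⟨⟩ ⇔-∘ (period⇔∈⟨maximal⟩ nonempty 0ₙ∉A adm w-order maximal ⇔-∘ sameNbhd⇔period)
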